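{- Let $G$ be a group and let $u_1,u_2,\dots,u_{2k}$ be vertices of the power graph $\mathfrak{g}(G)$. Then $u_1,\dots,u_{2k}$ is a hole in $\mathfrak{g}(G)$ if and only if $[u_1]_\sim,[u_2]_\sim,\dots,[u_{2k}]_\sim$ is a hole in the cyclic subgroup graph $C(G)$.
   Context: The power graph $\mathfrak{g}(G)$ has vertex set $G$, distinct $x,y$ adjacent iff $\langle x\rangle\le\langle y\rangle$ or $\langle y\rangle\le\langle x\rangle$. Define $x\sim y$ iff $\langle x\rangle=\langle y\rangle$, with classes $[x]_\sim$. The cyclic subgroup graph $C(G)$ is the undirected graph with vertex set $G/\!\sim$, where distinct classes $A,B$ are adjacent iff there exist $a\in A$, $b\in B$ with $\langle b\rangle<\langle a\rangle$ or $\langle a\rangle<\langle b\rangle$ (proper inclusion). A hole is a cycle such that no two of its vertices are joined by an edge not belonging to the cycle. -}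

module Defs where

open import Level using (Level; _⊔_)
open import Data.Nat using (ℕ; zero; suc; _≤_)
open import Data.Integer using (ℤ; +_; -[1+_])
open import Data.Fin using (Fin; toℕ)
open import Data.Product using (Σ; ∃; _×_)
open import Data.Sum using (_⊎_)
open import Relation.Nullary using (¬_)
open import Relation.Binary.PropositionalEquality using (_≡_; _≢_)
open import Algebra.Bundles using (Group)

CycSucc : ∀ {n} → Fin n → Fin n → Set
CycSucc {n} i j = (suc (toℕ i) ≡ toℕ j) ⊎ (suc (toℕ i) ≡ n × toℕ j ≡ 0)

CycAdj : ∀ {n} → Fin n → Fin n → Set
CycAdj i j = CycSucc i j ⊎ CycSucc j i

module _ {a r e : Level} {V : Set a} (_≈_ : V → V → Set r) (E : V → V → Set e) where

  record IsCycle {n : ℕ} (u : Fin n → V) : Set (a ⊔ r ⊔ e) where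
    field
      length≥3  : 3 ≤ n
      distinct  : ∀ i j → i ≢ j → ¬ (u i ≈ u j)
      edges     : ∀ i j → CycSucc i j → E (u i) (u j)

  record IsHole {n : ℕ} (u : Fin n → V) : Set (a ⊔ r ⊔ e) where
    field
      cycle     : IsCycle u
      noChord   : ∀ i j → i ≢ j → ¬ CycAdj i j → ¬ E (u i) (u j)

module GroupDefs {c ℓ : Level} (G : Group c ℓ) where
  open Group G

  powℕ : Carrier → ℕ → Carrier
  powℕ x zero    = ε
  powℕ x (suc n) = x ∙ powℕ x n

  powℤ : Carrier → ℤ → Carrier
  powℤ x (+ n)     = powℕ x n
  powℤ x -[1+ n ]  = (powℕ x (suc n)) ⁻¹

  _∈⟨_⟩ : Carrier → Carrier → Set ℓ
  x ∈⟨ y ⟩ = ∃ λ (m : ℤ) → x ≈ powℤ y m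

  _≤⟨⟩_ : Carrier → Carrier → Set ℓ
  x ≤⟨⟩ y = x ∈⟨ y ⟩

  _<⟨⟩_ : Carrier → Carrier → Set ℓ
  x <⟨⟩ y = (x ≤⟨⟩ y) × ¬ (y ≤⟨⟩ x)

  _∼_ : Carrier → Carrier → Set ℓ
  x ∼ y = (x ≤⟨⟩ y) × (y ≤⟨⟩ x)

  PowerAdj : Carrier → Carrier → Set ℓ
  PowerAdj x y = ¬ (x ≈ y) × ((x ≤⟨⟩ y) ⊎ (y ≤⟨⟩ x))

  -- cyclic subgroup graph C(G): vertex set G/∼, the class [x] being
  -- represented by x (vertex equality is ∼).
  CAdj : Carrier → Carrier → Set (c ⊔ ℓ)
  CAdj x y = ¬ (x ∼ y) ×
    (∃ λ a → ∃ λ b → a ∼ x × b ∼ y × ((b <⟨⟩ a) ⊎ (a <⟨⟩ b)))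

  PowerHole : ∀ {n} → (Fin n → Carrier) → Set (c ⊔ ℓ)
  PowerHole u = IsHole _≈_ PowerAdj u

  CHole : ∀ {n} → (Fin n → Carrier) → Set (c ⊔ ℓ)
  CHole u = IsHole _∼_ CAdj u

-- The relation ⟨x⟩ ≤ ⟨y⟩ is a preorder on G whose induced equivalence is ∼,
-- and between vertices of distinct ∼-classes the power graph and C(G) have
-- exactly the same edges.  So a hole in C(G) lifts to its representatives,
-- and a hole in 𝔤(G) yields one in C(G) as soon as its vertices lie in
-- distinct classes.  That they do when the hole has length at least 4: if
-- u i ∼ u j with j the successor of i, then u i sees the successor h of j
-- just as u j does, and i, h are not consecutive, giving a chord.  Evenness
-- serves only to exclude triangles.
module Submission where

open import Defs
open import Data.Nat using (ℕ; _*_; suc; zero; _≤_; _<_; s≤s; z≤n; _≟_)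
open import Data.Nat.Properties using (≤∧≢⇒<; <⇒≤; *-monoʳ-≤)
open import Data.Integer using (+_; -[1+_])
open import Data.Fin using (Fin; toℕ; fromℕ<) renaming (zero to fzero)
open import Data.Fin.Properties using (toℕ<n; toℕ-fromℕ<)
open import Data.Sum using (_⊎_; inj₁; inj₂; [_,_])
open import Data.Product using (∃; _×_; _,_; swap)
open import Relation.Nullary using (¬_; yes; no)
open import Relation.Binary.PropositionalEquality
  using (_≡_; _≢_; refl; cong) renaming (sym to ≡-sym)
open import Algebra.Bundles using (Group)
open import Function.Base using (_∘_)
open import Function.Bundles using (_⇔_; mk⇔)

-- CycSucc {n} i j unfolds to Next n (toℕ i) (toℕ j); on ℕ its equations can be matched on.
Next : ℕ → ℕ → ℕ → Set
Next n a b = (suc a ≡ b) ⊎ (suc a ≡ n × b ≡ 0)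

Next-irreflexive : ∀ {n a} → 2 ≤ n → ¬ Next n a a
Next-irreflexive _             (inj₁ ())
Next-irreflexive (s≤s (s≤s _)) (inj₂ (() , refl))

Next²-≢ : ∀ {n a b c} → 3 ≤ n → Next n a b → Next n b c → c ≢ a
Next²-≢ _                   (inj₁ refl)         (inj₁ refl)         ()
Next²-≢ (s≤s (s≤s (s≤s _))) (inj₁ refl)         (inj₂ (() , refl))  refl
Next²-≢ (s≤s (s≤s (s≤s _))) (inj₂ (() , refl))  (inj₁ refl)         refl

Next²-¬Next : ∀ {n a b c} → 3 ≤ n → Next n a b → Next n b c → ¬ Next n a c
Next²-¬Next _ (inj₁ refl) (inj₁ refl) (inj₁ ())
Next²-¬Next _ (inj₁ refl) (inj₁ refl) (inj₂ (_ , ()))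
Next²-¬Next _ (inj₁ refl) (inj₂ (refl , refl)) (inj₁ ())
Next²-¬Next _ (inj₁ refl) (inj₂ (refl , refl)) (inj₂ (() , refl))
Next²-¬Next (s≤s (s≤s (s≤s _))) (inj₂ (refl , refl)) (inj₁ refl) (inj₁ ())
Next²-¬Next _ (inj₂ (refl , refl)) (inj₁ refl) (inj₂ (_ , ()))
Next²-¬Next (s≤s (s≤s _)) (inj₂ (refl , refl)) (inj₂ (() , refl)) _

Next²-¬Next⁻¹ : ∀ {n a b c} → 4 ≤ n → Next n a b → Next n b c → ¬ Next n c a
Next²-¬Next⁻¹ _ (inj₁ refl) (inj₁ refl) (inj₁ ())
Next²-¬Next⁻¹ (s≤s (s≤s (s≤s (s≤s _)))) (inj₁ refl) (inj₁ refl) (inj₂ (() , refl))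
Next²-¬Next⁻¹ (s≤s (s≤s (s≤s (s≤s _)))) (inj₁ refl) (inj₂ (refl , refl)) (inj₁ ())
Next²-¬Next⁻¹ _ (inj₁ refl) (inj₂ (refl , refl)) (inj₂ (() , _))
Next²-¬Next⁻¹ (s≤s (s≤s (s≤s (s≤s _)))) (inj₂ (refl , refl)) (inj₁ refl) (inj₁ ())
Next²-¬Next⁻¹ (s≤s (s≤s (s≤s (s≤s _)))) (inj₂ (refl , refl)) (inj₁ refl) (inj₂ (() , _))
Next²-¬Next⁻¹ (s≤s (s≤s _)) (inj₂ (refl , refl)) (inj₂ (() , refl)) _

CycSucc⇒≢ : ∀ {n} → 2 ≤ n → {i j : Fin n} → CycSucc i j → i ≢ j
CycSucc⇒≢ n≥2 s refl = Next-irreflexive n≥2 s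

∃-CycSucc : ∀ {n} (i : Fin n) → ∃ (CycSucc i)
∃-CycSucc {suc n} i with suc (toℕ i) ≟ suc n
... | yes i+1≡n = fzero , inj₂ (i+1≡n , refl)
... | no  i+1≢n = fromℕ< i+1<n , inj₁ (≡-sym (toℕ-fromℕ< i+1<n))
  where
  i+1<n : suc (toℕ i) < suc n
  i+1<n = ≤∧≢⇒< (toℕ<n i) i+1≢n

3≤2*k⇒4≤2*k : ∀ k → 3 ≤ 2 * k → 4 ≤ 2 * k
3≤2*k⇒4≤2*k (suc (suc k)) _ = *-monoʳ-≤ 2 (s≤s (s≤s z≤n))
3≤2*k⇒4≤2*k (suc zero) (s≤s (s≤s ()))

module CyclicSubgroups {c ℓ} (G : Group c ℓ) where
  open Group G renaming (refl to ≈-refl)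
  open GroupDefs G
  open import Algebra.Properties.Group G
    using (ε⁻¹≈ε; ⁻¹-involutive; ⁻¹-anti-homo-∙; \\-leftDividesˡ; \\-leftDividesʳ)
  open import Relation.Binary.Reasoning.Setoid setoid

  module _ (z : Carrier) where

    ∈⟨⟩-resp-≈ : ∀ {g h} → g ≈ h → g ∈⟨ z ⟩ → h ∈⟨ z ⟩
    ∈⟨⟩-resp-≈ g≈h (m , g≈zᵐ) = m , trans (sym g≈h) g≈zᵐ

    z∙powℕ≈powℕ∙z : ∀ n → z ∙ powℕ z n ≈ powℕ z n ∙ z
    z∙powℕ≈powℕ∙z zero    = trans (identityʳ z) (sym (identityˡ z))
    z∙powℕ≈powℕ∙z (suc n) = trans (∙-congˡ (z∙powℕ≈powℕ∙z n)) (sym (assoc z (powℕ z n) z))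

    powℕ-suc⁻¹ : ∀ n → powℕ z (suc n) ⁻¹ ≈ z ⁻¹ ∙ powℕ z n ⁻¹
    powℕ-suc⁻¹ n = trans (⁻¹-cong (z∙powℕ≈powℕ∙z n)) (⁻¹-anti-homo-∙ (powℕ z n) z)

    powℕ⁻¹∈⟨⟩ : ∀ n → (powℕ z n ⁻¹) ∈⟨ z ⟩
    powℕ⁻¹∈⟨⟩ zero    = + 0 , ε⁻¹≈ε
    powℕ⁻¹∈⟨⟩ (suc n) = -[1+ n ] , ≈-refl

    z∙-∈⟨⟩ : ∀ {g} → g ∈⟨ z ⟩ → (z ∙ g) ∈⟨ z ⟩
    z∙-∈⟨⟩ (+ n , g≈zⁿ) = + suc n , ∙-congˡ g≈zⁿ
    z∙-∈⟨⟩ {g} (-[1+ n ] , g≈z⁻ⁿ⁻¹) = ∈⟨⟩-resp-≈ (sym z∙g≈z⁻ⁿ) (powℕ⁻¹∈⟨⟩ n)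
      where
      z∙g≈z⁻ⁿ : z ∙ g ≈ powℕ z n ⁻¹
      z∙g≈z⁻ⁿ = begin
        z ∙ g                     ≈⟨ ∙-congˡ (trans g≈z⁻ⁿ⁻¹ (powℕ-suc⁻¹ n)) ⟩
        z ∙ (z ⁻¹ ∙ powℕ z n ⁻¹)  ≈⟨ \\-leftDividesˡ z _ ⟩
        powℕ z n ⁻¹               ∎

    z⁻¹∙-∈⟨⟩ : ∀ {g} → g ∈⟨ z ⟩ → (z ⁻¹ ∙ g) ∈⟨ z ⟩
    z⁻¹∙-∈⟨⟩ (+ zero , g≈ε) =
      -[1+ 0 ] , trans (∙-congˡ g≈ε) (trans (identityʳ _) (⁻¹-cong (sym (identityʳ z))))
    z⁻¹∙-∈⟨⟩ (+ suc n , g≈zⁿ⁺¹) = + n , trans (∙-congˡ g≈zⁿ⁺¹) (\\-leftDividesʳ z _)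
    z⁻¹∙-∈⟨⟩ (-[1+ n ] , g≈z⁻ⁿ⁻¹) =
      -[1+ suc n ] , trans (∙-congˡ g≈z⁻ⁿ⁻¹) (sym (powℕ-suc⁻¹ (suc n)))

    powℕ∙-∈⟨⟩ : ∀ m {h} → h ∈⟨ z ⟩ → (powℕ z m ∙ h) ∈⟨ z ⟩
    powℕ∙-∈⟨⟩ zero    h∈ = ∈⟨⟩-resp-≈ (sym (identityˡ _)) h∈
    powℕ∙-∈⟨⟩ (suc m) h∈ = ∈⟨⟩-resp-≈ (sym (assoc z _ _)) (z∙-∈⟨⟩ (powℕ∙-∈⟨⟩ m h∈))

    powℕ⁻¹∙-∈⟨⟩ : ∀ m {h} → h ∈⟨ z ⟩ → (powℕ z m ⁻¹ ∙ h) ∈⟨ z ⟩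
    powℕ⁻¹∙-∈⟨⟩ zero    h∈ = ∈⟨⟩-resp-≈ (sym (trans (∙-congʳ ε⁻¹≈ε) (identityˡ _))) h∈
    powℕ⁻¹∙-∈⟨⟩ (suc m) {h} h∈ =
      ∈⟨⟩-resp-≈ eq (z⁻¹∙-∈⟨⟩ (powℕ⁻¹∙-∈⟨⟩ m h∈))
      where
      eq : z ⁻¹ ∙ (powℕ z m ⁻¹ ∙ h) ≈ powℕ z (suc m) ⁻¹ ∙ h
      eq = trans (sym (assoc _ _ h)) (∙-congʳ (sym (powℕ-suc⁻¹ m)))

    ∙-∈⟨⟩ : ∀ {g h} → g ∈⟨ z ⟩ → h ∈⟨ z ⟩ → (g ∙ h) ∈⟨ z ⟩
    ∙-∈⟨⟩ (+ m      , g≈zᵐ) h∈ = ∈⟨⟩-resp-≈ (∙-congʳ (sym g≈zᵐ)) (powℕ∙-∈⟨⟩ m h∈)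
    ∙-∈⟨⟩ (-[1+ m ] , g≈zᵐ) h∈ = ∈⟨⟩-resp-≈ (∙-congʳ (sym g≈zᵐ)) (powℕ⁻¹∙-∈⟨⟩ (suc m) h∈)

    ⁻¹-∈⟨⟩ : ∀ {g} → g ∈⟨ z ⟩ → (g ⁻¹) ∈⟨ z ⟩
    ⁻¹-∈⟨⟩ (+ m      , g≈zᵐ) = ∈⟨⟩-resp-≈ (⁻¹-cong (sym g≈zᵐ)) (powℕ⁻¹∈⟨⟩ m)
    ⁻¹-∈⟨⟩ (-[1+ m ] , g≈zᵐ) = + suc m , trans (⁻¹-cong g≈zᵐ) (⁻¹-involutive _)

  powℤ-∈⟨⟩ : ∀ {y z} → y ∈⟨ z ⟩ → ∀ m → powℤ y m ∈⟨ z ⟩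
  powℤ-∈⟨⟩ {y} {z} y∈ (+ m) = powℕ-∈⟨⟩ m
    where
    powℕ-∈⟨⟩ : ∀ m → powℕ y m ∈⟨ z ⟩
    powℕ-∈⟨⟩ zero    = + 0 , ≈-refl
    powℕ-∈⟨⟩ (suc m) = ∙-∈⟨⟩ z y∈ (powℕ-∈⟨⟩ m)
  powℤ-∈⟨⟩ {z = z} y∈ -[1+ m ] = ⁻¹-∈⟨⟩ z (powℤ-∈⟨⟩ y∈ (+ suc m))

  ≤⟨⟩-trans : ∀ {x y z} → x ≤⟨⟩ y → y ≤⟨⟩ z → x ≤⟨⟩ z
  ≤⟨⟩-trans {z = z} (m , x≈yᵐ) y≤z = ∈⟨⟩-resp-≈ z (sym x≈yᵐ) (powℤ-∈⟨⟩ y≤z m)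

  ≤⟨⟩-reflexive : ∀ {x y} → x ≈ y → x ≤⟨⟩ y
  ≤⟨⟩-reflexive x≈y = + 1 , trans x≈y (sym (identityʳ _))

  ∼-reflexive : ∀ {x y} → x ≈ y → x ∼ y
  ∼-reflexive x≈y = ≤⟨⟩-reflexive x≈y , ≤⟨⟩-reflexive (sym x≈y)

  ∼-sym : ∀ {x y} → x ∼ y → y ∼ x
  ∼-sym = swap

  PowerAdj⇒CAdj : ∀ {x y} → ¬ (x ∼ y) → PowerAdj x y → CAdj x y
  PowerAdj⇒CAdj {x} {y} x≁y (_ , inj₁ x≤y) =
    x≁y , x , y , ∼-reflexive ≈-refl , ∼-reflexive ≈-refl , inj₂ (x≤y , λ y≤x → x≁y (x≤y , y≤x))
  PowerAdj⇒CAdj {x} {y} x≁y (_ , inj₂ y≤x) =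
    x≁y , x , y , ∼-reflexive ≈-refl , ∼-reflexive ≈-refl , inj₁ (y≤x , λ x≤y → x≁y (x≤y , y≤x))

  CAdj⇒PowerAdj : ∀ {x y} → ¬ (x ≈ y) → CAdj x y → PowerAdj x y
  CAdj⇒PowerAdj x≉y (_ , _ , _ , (_ , x≤a) , (b≤y , _) , inj₂ (a≤b , _)) =
    x≉y , inj₁ (≤⟨⟩-trans x≤a (≤⟨⟩-trans a≤b b≤y))
  CAdj⇒PowerAdj x≉y (_ , _ , _ , (a≤x , _) , (_ , y≤b) , inj₁ (b≤a , _)) =
    x≉y , inj₂ (≤⟨⟩-trans y≤b (≤⟨⟩-trans b≤a a≤x))

  ∼-PowerAdj : ∀ {x y w} → x ∼ y → ¬ (x ≈ w) → PowerAdj y w → PowerAdj x w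
  ∼-PowerAdj (x≤y , _) x≉w (_ , inj₁ y≤w) = x≉w , inj₁ (≤⟨⟩-trans x≤y y≤w)
  ∼-PowerAdj (_ , y≤x) x≉w (_ , inj₂ w≤y) = x≉w , inj₂ (≤⟨⟩-trans w≤y y≤x)

  module _ {n : ℕ} {u : Fin n → Carrier} where

    PowerHole⇒distinct-classes : 4 ≤ n → PowerHole u → ∀ i j → i ≢ j → ¬ (u i ∼ u j)
    PowerHole⇒distinct-classes n≥4 hole i j i≢j ui∼uj@(ui≤uj , _) =
      noChord i j i≢j (λ { (inj₁ i→j) → consecutive-twins i→j ui∼uj
                         ; (inj₂ j→i) → consecutive-twins j→i (∼-sym ui∼uj) })
              (distinct i j i≢j , inj₁ ui≤uj)
      where
      open IsHole hole
      open IsCycle cycle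

      consecutive-twins : ∀ {a b} → CycSucc a b → ¬ (u a ∼ u b)
      consecutive-twins {a} {b} a→b ua∼ub with ∃-CycSucc b
      ... | h , b→h =
        noChord a h a≢h [ Next²-¬Next (<⇒≤ n≥4) a→b b→h , Next²-¬Next⁻¹ n≥4 a→b b→h ]
                (∼-PowerAdj ua∼ub (distinct a h a≢h) (edges b h b→h))
        where
        a≢h : a ≢ h
        a≢h a≡h = Next²-≢ (<⇒≤ n≥4) a→b b→h (cong toℕ (≡-sym a≡h))

    PowerHole⇒CHole : 4 ≤ n → PowerHole u → CHole u
    PowerHole⇒CHole n≥4 hole = record
      { cycle   = record
        { length≥3 = length≥3
        ; distinct = distinct-classes
        ; edges    = λ i j i→j → PowerAdj⇒CAdj
                       (distinct-classes i j (CycSucc⇒≢ (<⇒≤ (<⇒≤ n≥4)) i→j)) (edges i j i→j)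
        }
      ; noChord = λ i j i≢j non-consecutive → noChord i j i≢j non-consecutive ∘ CAdj⇒PowerAdj (distinct i j i≢j)
      }
      where
      open IsHole hole
      open IsCycle cycle
      distinct-classes : ∀ i j → i ≢ j → ¬ (u i ∼ u j)
      distinct-classes = PowerHole⇒distinct-classes n≥4 hole

    CHole⇒PowerHole : CHole u → PowerHole u
    CHole⇒PowerHole hole = record
      { cycle   = record
        { length≥3 = length≥3
        ; distinct = distinct-elements
        ; edges    = λ i j i→j → CAdj⇒PowerAdj
                       (distinct-elements i j (CycSucc⇒≢ (<⇒≤ length≥3) i→j)) (edges i j i→j)
        }
      ; noChord = λ i j i≢j non-consecutive → noChord i j i≢j non-consecutive ∘ PowerAdj⇒CAdj (distinct i j i≢j)
      }
      where
      open IsHole hole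
      open IsCycle cycle
      distinct-elements : ∀ i j → i ≢ j → ¬ (u i ≈ u j)
      distinct-elements i j i≢j = distinct i j i≢j ∘ ∼-reflexive

proposition14 : ∀ {c ℓ} (G : Group c ℓ) (k : ℕ) (u : Fin (2 * k) → Group.Carrier G)
    → GroupDefs.PowerHole G u ⇔ GroupDefs.CHole G u
proposition14 G k u = mk⇔
  (λ hole → PowerHole⇒CHole (3≤2*k⇒4≤2*k k (length≥3 (cycle hole))) hole)
  CHole⇒PowerHole
  where
  open CyclicSubgroups G
  open IsHole using (cycle)
  open IsCycle using (length≥3)
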